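{- If $\alpha$ is an odd perfect Gaussian integer, then $\alpha=\pi^k\gamma^2$ for some Gaussian prime $\pi$, some Gaussian integer $\gamma$ with $\gcd(\pi,\gamma)=1$, and some odd rational integer $k$.
   Context: $\mathbb{Z}[i]$ denotes the Gaussian integers. A Gaussian integer is called even if it is divisible by $1+i$, and odd otherwise. The sum-of-divisors function (Spira) is defined as follows: write a nonzero Gaussian integer as $\eta=\varepsilon\prod_i \pi_i^{k_i}$ with $\varepsilon\in\{\pm1,\pm i\}$ a unit and each $\pi_i$ a Gaussian prime in the first quadrant ($\mathrm{Re}(\pi_i)>0$, $\mathrm{Im}(\pi_i)\ge 0$), pairwise non-associate; then $\sigma(\eta)=\prod_i \frac{\pi_i^{k_i+1}-1}{\pi_i-1}$. A Gaussian integer $\eta$ is perfect if $\sigma(\eta)=(1+i)\eta$. -}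

module Defs where

open import Data.Integer as ℤ using (ℤ; +_; 0ℤ; 1ℤ)
open import Data.Nat as ℕ using (ℕ; zero; suc)
open import Data.List using (List; []; _∷_; map)
open import Data.List.Relation.Unary.All using (All)
open import Data.List.Relation.Unary.AllPairs using (AllPairs)
open import Data.Product using (Σ; _×_; _,_; ∃; proj₁; proj₂)
open import Data.Sum using (_⊎_)
open import Relation.Binary.PropositionalEquality using (_≡_)
open import Relation.Nullary using (¬_)

record 𝔾 : Set where
  constructor _+_i
  field
    re : ℤ
    im : ℤ
open 𝔾 public

infixl 6 _+ᵍ_ _-ᵍ_
infixl 7 _*ᵍ_

_+ᵍ_ : 𝔾 → 𝔾 → 𝔾
(a + b i) +ᵍ (c + d i) = (a ℤ.+ c) + (b ℤ.+ d) i

_-ᵍ_ : 𝔾 → 𝔾 → 𝔾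
(a + b i) -ᵍ (c + d i) = (a ℤ.- c) + (b ℤ.- d) i

_*ᵍ_ : 𝔾 → 𝔾 → 𝔾
(a + b i) *ᵍ (c + d i) = (a ℤ.* c ℤ.- b ℤ.* d) + (a ℤ.* d ℤ.+ b ℤ.* c) i

0ᵍ 1ᵍ iᵍ 1+i : 𝔾
0ᵍ = 0ℤ + 0ℤ i
1ᵍ = 1ℤ + 0ℤ i
iᵍ = 0ℤ + 1ℤ i
1+i = 1ℤ + 1ℤ i

_^ᵍ_ : 𝔾 → ℕ → 𝔾
x ^ᵍ zero = 1ᵍ
x ^ᵍ suc n = x *ᵍ (x ^ᵍ n)

_∣ᵍ_ : 𝔾 → 𝔾 → Set
a ∣ᵍ b = ∃ λ c → b ≡ c *ᵍ a

IsUnit : 𝔾 → Set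
IsUnit u = u ∣ᵍ 1ᵍ

Associated : 𝔾 → 𝔾 → Set
Associated a b = ∃ λ u → IsUnit u × b ≡ u *ᵍ a

GaussianPrime : 𝔾 → Set
GaussianPrime p = ¬ (p ≡ 0ᵍ) × ¬ IsUnit p ×
  (∀ a b → p ≡ a *ᵍ b → IsUnit a ⊎ IsUnit b)

CoprimeG : 𝔾 → 𝔾 → Set
CoprimeG a b = ∀ d → d ∣ᵍ a → d ∣ᵍ b → IsUnit d

Even Odd : 𝔾 → Set
Even a = 1+i ∣ᵍ a
Odd a = ¬ Even a

FirstQuadrant : 𝔾 → Set
FirstQuadrant z = (0ℤ ℤ.< re z) × (0ℤ ℤ.≤ im z)

geomSum : 𝔾 → ℕ → 𝔾
geomSum π zero = 1ᵍ
geomSum π (suc k) = geomSum π k +ᵍ π ^ᵍ suc k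

prodG : List 𝔾 → 𝔾
prodG [] = 1ᵍ
prodG (x ∷ xs) = x *ᵍ prodG xs

record PrimePower : Set where
  constructor pp
  field
    base : 𝔾
    exp  : ℕ
open PrimePower public

ValidPP : PrimePower → Set
ValidPP (pp π k) = GaussianPrime π × FirstQuadrant π × 1 ℕ.≤ k

IsFactorization : 𝔾 → 𝔾 → List PrimePower → Set
IsFactorization η ε fs =
  IsUnit ε × All ValidPP fs ×
  AllPairs (λ f g → ¬ Associated (base f) (base g)) fs ×
  η ≡ ε *ᵍ prodG (map (λ f → base f ^ᵍ exp f) fs)

σ-of : List PrimePower → 𝔾
σ-of fs = prodG (map (λ f → geomSum (base f) (exp f)) fs)

-- σ(η) = s (Spira), via the (essentially unique) factorization of η
SigmaIs : 𝔾 → 𝔾 → Set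
SigmaIs η s = ∃ λ ε → ∃ λ fs → IsFactorization η ε fs × σ-of fs ≡ s

Perfect : 𝔾 → Set
Perfect η = SigmaIs η (1+i *ᵍ η)

-- Write α = ε ∏ πⱼ^kⱼ. As α is odd, so is every πⱼ, i.e. πⱼ ≡ 1 mod 1 + i, hence 1 + πⱼ + ⋯ + πⱼ^kⱼ
-- is odd when kⱼ is even and even when kⱼ is odd. Since 1 + i divides σ(α) = (1 + i) α exactly once,
-- exactly one exponent k = 2m + 1 is odd, and α = ε π^k γ² with γ = ∏ πⱼ^(kⱼ/2) over the other primes.
-- Euclid's lemma, available because ℤ[i] is Euclidean for the norm, gives π ∤ γ, and the unit is
-- absorbed as ε π^k γ² = (ε π)^k (ε⁻ᵐ γ)².

module Submission where

open import Defs
open import Data.Nat as ℕ using (ℕ; zero; suc; NonZero; _*_)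
import Data.Nat.Properties as ℕP
import Data.Nat.Tactic.RingSolver as ℕSolver
open import Data.Integer as ℤ using (ℤ; +_; 0ℤ; 1ℤ)
import Data.Integer
import Data.Integer.Properties as ℤP
import Data.Integer.Tactic.RingSolver as ℤSolver
open import Data.Integer.DivMod using (_/ℕ_; _%ℕ_; a≡a%ℕn+[a/ℕn]*n; n%ℕd<d)
open import Data.List using (List; []; _∷_; map; _++_)
open import Data.List.Properties using (map-++)
open import Data.List.Relation.Unary.All using (All; []; _∷_; head; tail; zipWith)
import Data.List.Relation.Unary.All.Properties as All
open import Data.List.Relation.Unary.AllPairs using (AllPairs; _∷_)
open import Data.Product using (∃; ∃₂; _×_; _,_; proj₁; proj₂)
open import Data.Sum using (_⊎_; inj₁; inj₂; [_,_]′; map₁)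
open import Data.Empty using (⊥-elim)
open import Relation.Nullary using (¬_; yes; no)
open import Relation.Nullary.Decidable using (map′; _×-dec_; dec⇒maybe)
open import Relation.Binary.Definitions using (DecidableEquality)
open import Relation.Binary.PropositionalEquality
open import Induction.WellFounded using (Acc; acc)
open import Data.Nat.Induction using (<-wellFounded)
open import Level using (0ℓ)
open import Algebra.Structures {A = 𝔾} _≡_ using (IsCommutativeMonoid)
open import Algebra.Structures.Biased {A = 𝔾} _≡_ using (isCommutativeSemiringˡ)
open import Tactic.RingSolver.Core.AlmostCommutativeRing using (AlmostCommutativeRing)
open import Tactic.RingSolver using (solve-∀)

-- 𝔾 as a commutative ring

negᵍ : 𝔾 → 𝔾
negᵍ (a + b i) = (ℤ.- a) + (ℤ.- b) i

𝔾-ext : ∀ {a b c d} → a ≡ c → b ≡ d → a + b i ≡ c + d i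
𝔾-ext refl refl = refl

+ᵍ-assoc : ∀ x y z → (x +ᵍ y) +ᵍ z ≡ x +ᵍ (y +ᵍ z)
+ᵍ-assoc (a + b i) (c + d i) (e + f i) = 𝔾-ext (ℤP.+-assoc a c e) (ℤP.+-assoc b d f)

+ᵍ-comm : ∀ x y → x +ᵍ y ≡ y +ᵍ x
+ᵍ-comm (a + b i) (c + d i) = 𝔾-ext (ℤP.+-comm a c) (ℤP.+-comm b d)

+ᵍ-identityˡ : ∀ x → 0ᵍ +ᵍ x ≡ x
+ᵍ-identityˡ (a + b i) = 𝔾-ext (ℤP.+-identityˡ a) (ℤP.+-identityˡ b)

+ᵍ-identityʳ : ∀ x → x +ᵍ 0ᵍ ≡ x
+ᵍ-identityʳ (a + b i) = 𝔾-ext (ℤP.+-identityʳ a) (ℤP.+-identityʳ b)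

+ᵍ-inverseʳ : ∀ x → x +ᵍ negᵍ x ≡ 0ᵍ
+ᵍ-inverseʳ (a + b i) = 𝔾-ext (ℤP.+-inverseʳ a) (ℤP.+-inverseʳ b)

*ᵍ-assoc : ∀ x y z → (x *ᵍ y) *ᵍ z ≡ x *ᵍ (y *ᵍ z)
*ᵍ-assoc (a + b i) (c + d i) (e + f i) = 𝔾-ext (re-assoc a b c d e f) (im-assoc a b c d e f)
  where
  open Data.Integer using (_+_; _-_) renaming (_*_ to _·_)
  re-assoc : ∀ a b c d e f → (a · c - b · d) · e - (a · d + b · c) · f ≡ a · (c · e - d · f) - b · (c · f + d · e)
  re-assoc = ℤSolver.solve-∀
  im-assoc : ∀ a b c d e f → (a · c - b · d) · f + (a · d + b · c) · e ≡ a · (c · f + d · e) + b · (c · e - d · f)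
  im-assoc = ℤSolver.solve-∀

*ᵍ-comm : ∀ x y → x *ᵍ y ≡ y *ᵍ x
*ᵍ-comm (a + b i) (c + d i) = 𝔾-ext (re-comm a b c d) (im-comm a b c d)
  where
  open Data.Integer using (_+_; _-_) renaming (_*_ to _·_)
  re-comm : ∀ a b c d → a · c - b · d ≡ c · a - d · b
  re-comm = ℤSolver.solve-∀
  im-comm : ∀ a b c d → a · d + b · c ≡ c · b + d · a
  im-comm = ℤSolver.solve-∀

*ᵍ-identityˡ : ∀ x → 1ᵍ *ᵍ x ≡ x
*ᵍ-identityˡ (a + b i) = 𝔾-ext (re-identity a b) (im-identity a b)
  where
  open Data.Integer using (_+_; _-_) renaming (_*_ to _·_)
  re-identity : ∀ a b → 1ℤ · a - 0ℤ · b ≡ a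
  re-identity = ℤSolver.solve-∀
  im-identity : ∀ a b → 1ℤ · b + 0ℤ · a ≡ b
  im-identity = ℤSolver.solve-∀

*ᵍ-identityʳ : ∀ x → x *ᵍ 1ᵍ ≡ x
*ᵍ-identityʳ x = trans (*ᵍ-comm x 1ᵍ) (*ᵍ-identityˡ x)

*ᵍ-distribʳ-+ᵍ : ∀ x y z → (y +ᵍ z) *ᵍ x ≡ y *ᵍ x +ᵍ z *ᵍ x
*ᵍ-distribʳ-+ᵍ (a + b i) (c + d i) (e + f i) = 𝔾-ext (re-distrib a b c d e f) (im-distrib a b c d e f)
  where
  open Data.Integer using (_+_; _-_) renaming (_*_ to _·_)
  re-distrib : ∀ a b c d e f → (c + e) · a - (d + f) · b ≡ (c · a - d · b) + (e · a - f · b)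
  re-distrib = ℤSolver.solve-∀
  im-distrib : ∀ a b c d e f → (c + e) · b + (d + f) · a ≡ (c · b + d · a) + (e · b + f · a)
  im-distrib = ℤSolver.solve-∀

*ᵍ-zeroˡ : ∀ x → 0ᵍ *ᵍ x ≡ 0ᵍ
*ᵍ-zeroˡ (a + b i) = 𝔾-ext (re-zero a b) (im-zero a b)
  where
  open Data.Integer using (_+_; _-_) renaming (_*_ to _·_)
  re-zero : ∀ a b → 0ℤ · a - 0ℤ · b ≡ 0ℤ
  re-zero = ℤSolver.solve-∀
  im-zero : ∀ a b → 0ℤ · b + 0ℤ · a ≡ 0ℤ
  im-zero = ℤSolver.solve-∀

negᵍ-distribˡ-*ᵍ : ∀ x y → negᵍ x *ᵍ y ≡ negᵍ (x *ᵍ y)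
negᵍ-distribˡ-*ᵍ (a + b i) (c + d i) = 𝔾-ext (re-neg a b c d) (im-neg a b c d)
  where
  open Data.Integer using (_+_; _-_; -_) renaming (_*_ to _·_)
  re-neg : ∀ a b c d → (- a) · c - (- b) · d ≡ - (a · c - b · d)
  re-neg = ℤSolver.solve-∀
  im-neg : ∀ a b c d → (- a) · d + (- b) · c ≡ - (a · d + b · c)
  im-neg = ℤSolver.solve-∀

negᵍ-distrib-+ᵍ : ∀ x y → negᵍ x +ᵍ negᵍ y ≡ negᵍ (x +ᵍ y)
negᵍ-distrib-+ᵍ (a + b i) (c + d i) = 𝔾-ext (sym (ℤP.neg-distrib-+ a c)) (sym (ℤP.neg-distrib-+ b d))

_≟ᵍ_ : DecidableEquality 𝔾
(a + b i) ≟ᵍ (c + d i) =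
  map′ (λ (p , q) → 𝔾-ext p q) (λ e → cong re e , cong im e) ((a ℤ.≟ c) ×-dec (b ℤ.≟ d))

𝔾-ring : AlmostCommutativeRing 0ℓ 0ℓ
𝔾-ring = record
  { Carrier = 𝔾 ; _≈_ = _≡_ ; _+_ = _+ᵍ_ ; _*_ = _*ᵍ_ ; -_ = negᵍ ; 0# = 0ᵍ ; 1# = 1ᵍ
  ; 0≟_ = λ x → dec⇒maybe (0ᵍ ≟ᵍ x)
  ; isAlmostCommutativeRing = record
    { isCommutativeSemiring = isCommutativeSemiringˡ record
      { +-isCommutativeMonoid = commutativeMonoid _+ᵍ_ +ᵍ-assoc +ᵍ-identityˡ +ᵍ-identityʳ +ᵍ-comm
      ; *-isCommutativeMonoid = commutativeMonoid _*ᵍ_ *ᵍ-assoc *ᵍ-identityˡ *ᵍ-identityʳ *ᵍ-comm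
      ; distribʳ = *ᵍ-distribʳ-+ᵍ
      ; zeroˡ = *ᵍ-zeroˡ
      }
    ; -‿cong = cong negᵍ
    ; -‿*-distribˡ = negᵍ-distribˡ-*ᵍ
    ; -‿+-comm = negᵍ-distrib-+ᵍ
    }
  }
  where
  commutativeMonoid : ∀ _∙_ {ε} → (∀ x y z → (x ∙ y) ∙ z ≡ x ∙ (y ∙ z)) →
    (∀ x → ε ∙ x ≡ x) → (∀ x → x ∙ ε ≡ x) → (∀ x y → x ∙ y ≡ y ∙ x) → IsCommutativeMonoid _∙_ ε
  commutativeMonoid _∙_ assoc idˡ idʳ comm = record
    { isMonoid = record
      { isSemigroup = record
        { isMagma = record { isEquivalence = isEquivalence ; ∙-cong = cong₂ _∙_ }
        ; assoc = assoc }
      ; identity = idˡ , idʳ }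
    ; comm = comm }

∣ᵍ-refl : ∀ a → a ∣ᵍ a
∣ᵍ-refl a = 1ᵍ , sym (*ᵍ-identityˡ a)

∣ᵍ-trans : ∀ {a b c} → a ∣ᵍ b → b ∣ᵍ c → a ∣ᵍ c
∣ᵍ-trans {a} (x , b≡xa) (y , c≡yb) = y *ᵍ x , trans c≡yb (trans (cong (y *ᵍ_) b≡xa) (sym (*ᵍ-assoc y x a)))

∣ᵍ-*ˡ : ∀ {a b} c → a ∣ᵍ b → a ∣ᵍ (c *ᵍ b)
∣ᵍ-*ˡ c a∣b = ∣ᵍ-trans a∣b (c , refl)

∣ᵍ-*ʳ : ∀ {a b} c → a ∣ᵍ b → a ∣ᵍ (b *ᵍ c)
∣ᵍ-*ʳ {a} {b} c a∣b = subst (a ∣ᵍ_) (*ᵍ-comm c b) (∣ᵍ-*ˡ c a∣b)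

∣ᵍ-+ : ∀ {a b c} → a ∣ᵍ b → a ∣ᵍ c → a ∣ᵍ (b +ᵍ c)
∣ᵍ-+ {a} (x , refl) (y , refl) = x +ᵍ y , sym (*ᵍ-distribʳ-+ᵍ a x y)

*ᵍ-∣ᵍ-* : ∀ {a b c d} → a ∣ᵍ b → c ∣ᵍ d → (a *ᵍ c) ∣ᵍ (b *ᵍ d)
*ᵍ-∣ᵍ-* {a} {c = c} (x , refl) (y , refl) = x *ᵍ y , regroup x a y c
  where
  regroup : ∀ x a y c → (x *ᵍ a) *ᵍ (y *ᵍ c) ≡ (x *ᵍ y) *ᵍ (a *ᵍ c)
  regroup = solve-∀ 𝔾-ring

inverse-cancelˡ : ∀ u' u x → 1ᵍ ≡ u' *ᵍ u → x ≡ u' *ᵍ (u *ᵍ x)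
inverse-cancelˡ u' u x 1≡u'u = trans (sym (*ᵍ-identityˡ x)) (trans (cong (_*ᵍ x) 1≡u'u) (*ᵍ-assoc u' u x))

IsUnit-*⁻ˡ : ∀ a b → IsUnit (a *ᵍ b) → IsUnit a
IsUnit-*⁻ˡ a b u∣1 = ∣ᵍ-trans (∣ᵍ-*ʳ b (∣ᵍ-refl a)) u∣1

IsUnit-^ : ∀ {u} n → IsUnit u → IsUnit (u ^ᵍ n)
IsUnit-^ zero _ = ∣ᵍ-refl 1ᵍ
IsUnit-^ (suc n) u∣1 = ∣ᵍ-trans (*ᵍ-∣ᵍ-* u∣1 (IsUnit-^ n u∣1)) (1ᵍ , refl)

∣ᵍ-unit-*⁻ : ∀ {a u b} → IsUnit u → a ∣ᵍ (u *ᵍ b) → a ∣ᵍ b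
∣ᵍ-unit-*⁻ {a} {u} {b} (u' , 1≡u'u) a∣ub = subst (a ∣ᵍ_) (sym (inverse-cancelˡ u' u b 1≡u'u)) (∣ᵍ-*ˡ u' a∣ub)

associated⇒∣ᵍ : ∀ {a b} → Associated a b → a ∣ᵍ b
associated⇒∣ᵍ (u , _ , b≡ua) = u , b≡ua

associated-sym : ∀ {a b} → Associated a b → Associated b a
associated-sym {a} (u , (u' , 1≡u'u) , refl) = u' , (u , trans 1≡u'u (*ᵍ-comm u' u)) , inverse-cancelˡ u' u a 1≡u'u

-- Norm

N : 𝔾 → ℕ
N (a + b i) = ℤ.∣ a ∣ * ℤ.∣ a ∣ ℕ.+ ℤ.∣ b ∣ * ℤ.∣ b ∣

∣i∣*∣i∣≡i*i : ∀ a → + (ℤ.∣ a ∣ * ℤ.∣ a ∣) ≡ a ℤ.* a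
∣i∣*∣i∣≡i*i (+ n) = ℤP.pos-* n n
∣i∣*∣i∣≡i*i ℤ.-[1+ n ] = ℤP.pos-* (suc n) (suc n)

N-asℤ : ∀ z → + N z ≡ re z ℤ.* re z ℤ.+ im z ℤ.* im z
N-asℤ (a + b i) = trans (ℤP.pos-+ (ℤ.∣ a ∣ * ℤ.∣ a ∣) _) (cong₂ ℤ._+_ (∣i∣*∣i∣≡i*i a) (∣i∣*∣i∣≡i*i b))

N-* : ∀ x y → N (x *ᵍ y) ≡ N x * N y
N-* x@(a + b i) y@(c + d i) = ℤP.+-injective (begin
  + N (x *ᵍ y)                                         ≡⟨ N-asℤ (x *ᵍ y) ⟩
  _                                                    ≡⟨ brahmagupta a b c d ⟩
  (a ℤ.* a ℤ.+ b ℤ.* b) ℤ.* (c ℤ.* c ℤ.+ d ℤ.* d)      ≡⟨ cong₂ ℤ._*_ (sym (N-asℤ x)) (sym (N-asℤ y)) ⟩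
  + N x ℤ.* + N y                                      ≡⟨ ℤP.pos-* (N x) (N y) ⟨
  + (N x * N y)                                        ∎)
  where
  open ≡-Reasoning
  open Data.Integer using (_+_; _-_) renaming (_*_ to _·_)
  brahmagupta : ∀ a b c d →
    (a · c - b · d) · (a · c - b · d) + (a · d + b · c) · (a · d + b · c) ≡ (a · a + b · b) · (c · c + d · d)
  brahmagupta = ℤSolver.solve-∀

N≡0⇒≡0ᵍ : ∀ z → N z ≡ 0 → z ≡ 0ᵍ
N≡0⇒≡0ᵍ (a + b i) eq = 𝔾-ext (square≡0 a (ℕP.m+n≡0⇒m≡0 _ eq)) (square≡0 b (ℕP.m+n≡0⇒n≡0 _ eq))
  where
  square≡0 : ∀ a → ℤ.∣ a ∣ * ℤ.∣ a ∣ ≡ 0 → a ≡ 0ℤ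
  square≡0 a e with ℕP.m*n≡0⇒m≡0∨n≡0 ℤ.∣ a ∣ e
  ... | inj₁ p = ℤP.∣i∣≡0⇒i≡0 p
  ... | inj₂ p = ℤP.∣i∣≡0⇒i≡0 p

conj : 𝔾 → 𝔾
conj (a + b i) = a + (ℤ.- b) i

N-conj : ∀ z → N (conj z) ≡ N z
N-conj (a + b i) rewrite ℤP.∣-i∣≡∣i∣ b = refl

*ᵍ-conj : ∀ z → z *ᵍ conj z ≡ (+ N z) + 0ℤ i
*ᵍ-conj z@(a + b i) = 𝔾-ext (trans (re-conj a b) (sym (N-asℤ z))) (im-conj a b)
  where
  open Data.Integer using (_+_; _-_; -_) renaming (_*_ to _·_)
  re-conj : ∀ a b → a · a - b · (- b) ≡ a · a + b · b
  re-conj = ℤSolver.solve-∀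
  im-conj : ∀ a b → a · (- b) + b · a ≡ 0ℤ
  im-conj = ℤSolver.solve-∀

*ᵍ-cancelˡ : ∀ c x y → ¬ c ≡ 0ᵍ → c *ᵍ x ≡ c *ᵍ y → x ≡ y
*ᵍ-cancelˡ c x y c≢0 cx≡cy = begin
  x                  ≡⟨ split x y ⟩
  y +ᵍ (x +ᵍ negᵍ y) ≡⟨ cong (y +ᵍ_) x-y≡0 ⟩
  y +ᵍ 0ᵍ            ≡⟨ +ᵍ-identityʳ y ⟩
  y                  ∎
  where
  open ≡-Reasoning
  split : ∀ x y → x ≡ y +ᵍ (x +ᵍ negᵍ y)
  split = solve-∀ 𝔾-ring
  distribute : ∀ c x y → c *ᵍ (x +ᵍ negᵍ y) ≡ c *ᵍ x +ᵍ negᵍ (c *ᵍ y)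
  distribute = solve-∀ 𝔾-ring
  c[x-y]≡0 : c *ᵍ (x +ᵍ negᵍ y) ≡ 0ᵍ
  c[x-y]≡0 = trans (distribute c x y) (trans (cong (λ z → z +ᵍ negᵍ (c *ᵍ y)) cx≡cy) (+ᵍ-inverseʳ (c *ᵍ y)))
  Nc*N[x-y]≡0 : N c * N (x +ᵍ negᵍ y) ≡ 0
  Nc*N[x-y]≡0 = trans (sym (N-* c (x +ᵍ negᵍ y))) (cong N c[x-y]≡0)
  x-y≡0 : x +ᵍ negᵍ y ≡ 0ᵍ
  x-y≡0 = [ (λ Nc≡0 → ⊥-elim (c≢0 (N≡0⇒≡0ᵍ c Nc≡0))) , N≡0⇒≡0ᵍ (x +ᵍ negᵍ y) ]′
    (ℕP.m*n≡0⇒m≡0∨n≡0 (N c) Nc*N[x-y]≡0)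

∣ᵍ-cancelˡ : ∀ c {a b} → ¬ c ≡ 0ᵍ → (c *ᵍ a) ∣ᵍ (c *ᵍ b) → a ∣ᵍ b
∣ᵍ-cancelˡ c {a} {b} c≢0 (t , cb≡t[ca]) = t , *ᵍ-cancelˡ c b (t *ᵍ a) c≢0 (trans cb≡t[ca] (rotate t c a))
  where
  rotate : ∀ t c a → t *ᵍ (c *ᵍ a) ≡ c *ᵍ (t *ᵍ a)
  rotate = solve-∀ 𝔾-ring

-- Division with remainder

∣m⊖n∣≤n : ∀ m n → m ℕ.< n ℕ.+ n → ℤ.∣ m ℤ.⊖ n ∣ ℕ.≤ n
∣m⊖n∣≤n m n m<2n with m ℕ.≤? n
... | yes m≤n = subst (ℕ._≤ n) (sym (ℤP.∣⊖∣-≤ m≤n)) (ℕP.m∸n≤m n m)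
... | no m≰n = subst (ℕ._≤ n) (sym (trans (ℤP.∣m⊖n∣≡∣n⊖m∣ m n) (ℤP.∣⊖∣-< n<m)))
    (ℕP.<⇒≤ (subst (m ℕ.∸ n ℕ.<_) (ℕP.m+n∸n≡m n n) (ℕP.∸-monoˡ-< m<2n (ℕP.<⇒≤ n<m))))
  where
  n<m : n ℕ.< m
  n<m = ℕP.≰⇒> m≰n

nearestMultiple : ∀ x n → .{{_ : NonZero n}} → ∃ λ q → 2 * ℤ.∣ x ℤ.- q ℤ.* + n ∣ ℕ.≤ n
nearestMultiple x n@(suc _) = q , (begin
  2 * ℤ.∣ x ℤ.- q ℤ.* + n ∣       ≡⟨ ℤP.abs-* (+ 2) (x ℤ.- q ℤ.* + n) ⟨
  ℤ.∣ + 2 ℤ.* (x ℤ.- q ℤ.* + n) ∣ ≡⟨ cong ℤ.∣_∣ twice-distance ⟩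
  ℤ.∣ s ℤ.⊖ n ∣                   ≤⟨ ∣m⊖n∣≤n s n s<2n ⟩
  n                               ∎)
  where
  open ℕP.≤-Reasoning
  open Data.Integer using (_+_; _-_) renaming (_*_ to _·_)
  t q : ℤ
  t = x · + 2 + + n
  q = t /ℕ (2 * n)
  s : ℕ
  s = t %ℕ (2 * n)
  s<2n : s ℕ.< n ℕ.+ n
  s<2n = subst (s ℕ.<_) (cong (n ℕ.+_) (ℕP.+-identityʳ n)) (n%ℕd<d t (2 * n))
  t≡s+q·2n : t ≡ + s + q · (+ 2 · + n)
  t≡s+q·2n = trans (a≡a%ℕn+[a/ℕn]*n t (2 * n)) (cong (λ z → + s + q · z) (ℤP.pos-* 2 n))
  expand : ∀ x q m → + 2 · (x - q · m) ≡ (x · + 2 + m) - q · (+ 2 · m) - m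
  expand = ℤSolver.solve-∀
  cancel : ∀ s q m → (s + q · (+ 2 · m)) - q · (+ 2 · m) - m ≡ s - m
  cancel = ℤSolver.solve-∀
  twice-distance : + 2 · (x - q · + n) ≡ s ℤ.⊖ n
  twice-distance = trans (expand x q (+ n))
    (trans (cong (λ z → z - q · (+ 2 · + n) - + n) t≡s+q·2n)
      (trans (cancel (+ s) q (+ n)) (ℤP.m-n≡m⊖n s n)))

halfBoundedSquares⇒< : ∀ r n u v → .{{_ : NonZero n}} → r * n ≡ u * u ℕ.+ v * v →
  2 * u ℕ.≤ n → 2 * v ℕ.≤ n → r ℕ.< n
halfBoundedSquares⇒< r n u v e 2u≤n 2v≤n = double≤⇒< r 2r≤n
  where
  four-squares : ∀ u v → (2 * u) * (2 * u) ℕ.+ (2 * v) * (2 * v) ≡ 4 * (u * u ℕ.+ v * v)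
  four-squares = ℕSolver.solve-∀
  regroup : ∀ r n → 4 * (r * n) ≡ (r * 2) * (n * 2)
  regroup = ℕSolver.solve-∀
  double-square : ∀ n → n * n ℕ.+ n * n ≡ n * (n * 2)
  double-square = ℕSolver.solve-∀
  4rn≤2n² : (r * 2) * (n * 2) ℕ.≤ n * (n * 2)
  4rn≤2n² = subst₂ ℕ._≤_ (trans (four-squares u v) (trans (cong (4 *_) (sym e)) (regroup r n))) (double-square n)
    (ℕP.+-mono-≤ (ℕP.*-mono-≤ 2u≤n 2u≤n) (ℕP.*-mono-≤ 2v≤n 2v≤n))
  2r≤n : r * 2 ℕ.≤ n
  2r≤n = ℕP.*-cancelʳ-≤ (r * 2) n (n * 2) {{ℕP.m*n≢0 n 2}} 4rn≤2n²
  double≤⇒< : ∀ r → r * 2 ℕ.≤ n → r ℕ.< n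
  double≤⇒< zero _ = ℕ.>-nonZero⁻¹ n
  double≤⇒< r@(suc _) 2r≤n = ℕP.<-≤-trans (ℕP.m<m*n r 2 ℕP.≤-refl) 2r≤n

DivisionWithRemainder : 𝔾 → 𝔾 → Set
DivisionWithRemainder a b = ∃₂ λ q r → a ≡ q *ᵍ b +ᵍ r × N r ℕ.< N b

-- q rounds both coordinates of a · conj b / N b to the nearest integer, so those of r · conj b
-- are at most N b / 2 in absolute value, and N r · N b = N (r · conj b) ≤ N b² / 2.
euclideanDivision : ∀ a b → ¬ b ≡ 0ᵍ → DivisionWithRemainder a b
euclideanDivision a b b≢0 = q , r , a≡qb+r , halfBoundedSquares⇒< (N r) (N b) u v Nr*Nb≡u²+v² 2u≤Nb 2v≤Nb
  where
  instance
    Nb≢0 : NonZero (N b)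
    Nb≢0 = ℕ.≢-nonZero (λ Nb≡0 → b≢0 (N≡0⇒≡0ᵍ b Nb≡0))
  w : 𝔾
  w = a *ᵍ conj b
  qx qy : ℤ
  qx = proj₁ (nearestMultiple (re w) (N b))
  qy = proj₁ (nearestMultiple (im w) (N b))
  q r : 𝔾
  q = qx + qy i
  r = a +ᵍ negᵍ (q *ᵍ b)
  u v : ℕ
  u = ℤ.∣ re w ℤ.- qx ℤ.* + N b ∣
  v = ℤ.∣ im w ℤ.- qy ℤ.* + N b ∣
  2u≤Nb : 2 * u ℕ.≤ N b
  2u≤Nb = proj₂ (nearestMultiple (re w) (N b))
  2v≤Nb : 2 * v ℕ.≤ N b
  2v≤Nb = proj₂ (nearestMultiple (im w) (N b))
  a≡qb+r : a ≡ q *ᵍ b +ᵍ r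
  a≡qb+r = add-subtract a q b
    where
    add-subtract : ∀ a q b → a ≡ q *ᵍ b +ᵍ (a +ᵍ negᵍ (q *ᵍ b))
    add-subtract = solve-∀ 𝔾-ring
  distribute : ∀ a q b c → (a +ᵍ negᵍ (q *ᵍ b)) *ᵍ c ≡ a *ᵍ c +ᵍ negᵍ (q *ᵍ (b *ᵍ c))
  distribute = solve-∀ 𝔾-ring
  subtract-scaled : ∀ x y qx qy n → (x + y i) +ᵍ negᵍ ((qx + qy i) *ᵍ (n + 0ℤ i)) ≡ (x ℤ.- qx ℤ.* n) + (y ℤ.- qy ℤ.* n) i
  subtract-scaled x y qx qy n = 𝔾-ext (re-sub x y qx qy n) (im-sub x y qx qy n)
    where
    open Data.Integer using (_+_; _-_; -_) renaming (_*_ to _·_)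
    re-sub : ∀ x y qx qy n → x + - (qx · n - qy · 0ℤ) ≡ x - qx · n
    re-sub = ℤSolver.solve-∀
    im-sub : ∀ x y qx qy n → y + - (qx · 0ℤ + qy · n) ≡ y - qy · n
    im-sub = ℤSolver.solve-∀
  r*conj-b : r *ᵍ conj b ≡ (re w ℤ.- qx ℤ.* + N b) + (im w ℤ.- qy ℤ.* + N b) i
  r*conj-b = trans (distribute a q b (conj b))
    (trans (cong (λ z → w +ᵍ negᵍ (q *ᵍ z)) (*ᵍ-conj b)) (subtract-scaled (re w) (im w) qx qy (+ N b)))
  Nr*Nb≡u²+v² : N r * N b ≡ u * u ℕ.+ v * v
  Nr*Nb≡u²+v² = trans (cong (N r *_) (sym (N-conj b))) (trans (sym (N-* r (conj b))) (cong N r*conj-b))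

-- Bézout and Euclid's lemma

Bezout : 𝔾 → 𝔾 → Set
Bezout a b = ∃ λ d → d ∣ᵍ a × d ∣ᵍ b × ∃₂ λ x y → d ≡ x *ᵍ a +ᵍ y *ᵍ b

bezout : ∀ a b → Bezout a b
bezout a b = go a b (<-wellFounded (N b))
  where
  go : ∀ a b → Acc ℕ._<_ (N b) → Bezout a b
  go a b _ with b ≟ᵍ 0ᵍ
  go a b _ | yes refl = a , ∣ᵍ-refl a , (0ᵍ , sym (*ᵍ-zeroˡ a)) , 1ᵍ , 0ᵍ , combination a
    where
    combination : ∀ a → a ≡ 1ᵍ *ᵍ a +ᵍ 0ᵍ *ᵍ 0ᵍ
    combination = solve-∀ 𝔾-ring
  go a b (acc rec) | no b≢0 = descend (euclideanDivision a b b≢0)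
    where
    -- Taking the division as an argument, rather than abstracting it with `with`,
    -- keeps Agda from normalising its (large) witness.
    descend : DivisionWithRemainder a b → Bezout a b
    descend (q , r , a≡qb+r , Nr<Nb) with go b r (rec Nr<Nb)
    ... | d , d∣b , d∣r , x , y , d≡xb+yr =
      d , subst (d ∣ᵍ_) (sym a≡qb+r) (∣ᵍ-+ (∣ᵍ-*ˡ q d∣b) d∣r) , d∣b , y , x +ᵍ negᵍ (y *ᵍ q) ,
      trans d≡xb+yr (trans (eliminate-r x y q b r) (cong (λ z → y *ᵍ z +ᵍ (x +ᵍ negᵍ (y *ᵍ q)) *ᵍ b) (sym a≡qb+r)))
      where
      eliminate-r : ∀ x y q b r → x *ᵍ b +ᵍ y *ᵍ r ≡ y *ᵍ (q *ᵍ b +ᵍ r) +ᵍ (x +ᵍ negᵍ (y *ᵍ q)) *ᵍ b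
      eliminate-r = solve-∀ 𝔾-ring

euclidsLemma : ∀ p a b → GaussianPrime p → p ∣ᵍ (a *ᵍ b) → p ∣ᵍ a ⊎ p ∣ᵍ b
euclidsLemma p a b (_ , _ , irreducible) p∣ab with bezout p a
... | d , (e , p≡ed) , d∣a , x , y , d≡xp+ya with irreducible e d p≡ed
... | inj₁ e-unit = inj₁ (∣ᵍ-trans (associated⇒∣ᵍ (associated-sym (e , e-unit , p≡ed))) d∣a)
... | inj₂ (d' , 1≡d'd) = inj₂ (subst (p ∣ᵍ_) (sym b≡combination) (∣ᵍ-+ (∣ᵍ-*ˡ (d' *ᵍ x *ᵍ b) (∣ᵍ-refl p)) (∣ᵍ-*ˡ (d' *ᵍ y) p∣ab)))
  where
  expand : ∀ d' x p y a b → d' *ᵍ (x *ᵍ p +ᵍ y *ᵍ a) *ᵍ b ≡ d' *ᵍ x *ᵍ b *ᵍ p +ᵍ d' *ᵍ y *ᵍ (a *ᵍ b)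
  expand = solve-∀ 𝔾-ring
  b≡combination : b ≡ d' *ᵍ x *ᵍ b *ᵍ p +ᵍ d' *ᵍ y *ᵍ (a *ᵍ b)
  b≡combination = begin
    b                                       ≡⟨ *ᵍ-identityˡ b ⟨
    1ᵍ *ᵍ b                                 ≡⟨ cong (_*ᵍ b) (trans 1≡d'd (cong (d' *ᵍ_) d≡xp+ya)) ⟩
    d' *ᵍ (x *ᵍ p +ᵍ y *ᵍ a) *ᵍ b           ≡⟨ expand d' x p y a b ⟩
    d' *ᵍ x *ᵍ b *ᵍ p +ᵍ d' *ᵍ y *ᵍ (a *ᵍ b) ∎
    where open ≡-Reasoning

prime∤1 : ∀ {p} → GaussianPrime p → ¬ p ∣ᵍ 1ᵍ
prime∤1 (_ , non-unit , _) = non-unit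

prime∣^⇒prime∣ : ∀ {p} b n → GaussianPrime p → p ∣ᵍ (b ^ᵍ n) → p ∣ᵍ b
prime∣^⇒prime∣ b zero p-prime p∣1 = ⊥-elim (prime∤1 p-prime p∣1)
prime∣^⇒prime∣ {p} b (suc n) p-prime p∣bbⁿ with euclidsLemma p b (b ^ᵍ n) p-prime p∣bbⁿ
... | inj₁ p∣b = p∣b
... | inj₂ p∣bⁿ = prime∣^⇒prime∣ b n p-prime p∣bⁿ

prime∣prime⇒associated : ∀ {p q} → GaussianPrime p → GaussianPrime q → p ∣ᵍ q → Associated p q
prime∣prime⇒associated {p} (_ , non-unit , _) (_ , _ , irreducible) (t , q≡tp) with irreducible t p q≡tp
... | inj₁ t-unit = t , t-unit , q≡tp
... | inj₂ p-unit = ⊥-elim (non-unit p-unit)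

prime∤⇒coprime : ∀ {p γ} → GaussianPrime p → ¬ p ∣ᵍ γ → CoprimeG p γ
prime∤⇒coprime (_ , _ , irreducible) p∤γ d (c , p≡cd) d∣γ with irreducible c d p≡cd
... | inj₁ c-unit = ⊥-elim (p∤γ (∣ᵍ-trans (associated⇒∣ᵍ (associated-sym (c , c-unit , p≡cd))) d∣γ))
... | inj₂ d-unit = d-unit

unit*prime : ∀ {u p} → IsUnit u → GaussianPrime p → GaussianPrime (u *ᵍ p)
unit*prime {u} {p} (u' , 1≡u'u) (p≢0 , p-non-unit , irreducible) = up≢0 , up-non-unit , up-irreducible
  where
  p≡u'[up] : p ≡ u' *ᵍ (u *ᵍ p)
  p≡u'[up] = inverse-cancelˡ u' u p 1≡u'u
  up≢0 : ¬ u *ᵍ p ≡ 0ᵍ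
  up≢0 up≡0 = p≢0 (trans p≡u'[up] (trans (cong (u' *ᵍ_) up≡0) (trans (*ᵍ-comm u' 0ᵍ) (*ᵍ-zeroˡ u'))))
  up-non-unit : ¬ IsUnit (u *ᵍ p)
  up-non-unit up∣1 = p-non-unit (∣ᵍ-trans (∣ᵍ-*ˡ u (∣ᵍ-refl p)) up∣1)
  up-irreducible : ∀ a b → u *ᵍ p ≡ a *ᵍ b → IsUnit a ⊎ IsUnit b
  up-irreducible a b up≡ab = map₁ (λ u'a-unit → IsUnit-*⁻ˡ a u' (subst IsUnit (*ᵍ-comm u' a) u'a-unit))
    (irreducible (u' *ᵍ a) b (trans p≡u'[up] (trans (cong (u' *ᵍ_) up≡ab) (sym (*ᵍ-assoc u' a b)))))

-- Congruences and parity

infix 4 _≡ᵍ_mod_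
record _≡ᵍ_mod_ (a b m : 𝔾) : Set where
  constructor _,_
  field
    quotient : 𝔾
    a≡b+quotient*m : a ≡ b +ᵍ quotient *ᵍ m

mod-refl : ∀ a m → a ≡ᵍ a mod m
mod-refl a m = 0ᵍ , add-zero a m
  where
  add-zero : ∀ a m → a ≡ a +ᵍ 0ᵍ *ᵍ m
  add-zero = solve-∀ 𝔾-ring

mod-trans : ∀ {a b c m} → a ≡ᵍ b mod m → b ≡ᵍ c mod m → a ≡ᵍ c mod m
mod-trans {c = c} {m} (x , refl) (y , refl) = y +ᵍ x , regroup c y x m
  where
  regroup : ∀ c y x m → (c +ᵍ y *ᵍ m) +ᵍ x *ᵍ m ≡ c +ᵍ (y +ᵍ x) *ᵍ m
  regroup = solve-∀ 𝔾-ring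

mod-*-cong : ∀ {a b c d m} → a ≡ᵍ b mod m → c ≡ᵍ d mod m → a *ᵍ c ≡ᵍ b *ᵍ d mod m
mod-*-cong {b = b} {d = d} {m} (x , refl) (y , refl) = x *ᵍ d +ᵍ b *ᵍ y +ᵍ x *ᵍ y *ᵍ m , expand b x d y m
  where
  expand : ∀ b x d y m → (b +ᵍ x *ᵍ m) *ᵍ (d +ᵍ y *ᵍ m) ≡ b *ᵍ d +ᵍ (x *ᵍ d +ᵍ b *ᵍ y +ᵍ x *ᵍ y *ᵍ m) *ᵍ m
  expand = solve-∀ 𝔾-ring

∣ᵍ-resp-mod : ∀ {a b m} → a ≡ᵍ b mod m → m ∣ᵍ b → m ∣ᵍ a
∣ᵍ-resp-mod {m = m} (x , refl) m∣b = ∣ᵍ-+ m∣b (∣ᵍ-*ˡ x (∣ᵍ-refl m))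

-- a + b i = s + (q + (b - q) i)(1 + i) where a + b = s + 2q.
residue-mod-1+i : ∀ z → ∃ λ s → s ℕ.< 2 × z ≡ᵍ (+ s) + 0ℤ i mod 1+i
residue-mod-1+i (a + b i) = s , n%ℕd<d t 2 , (q + (b ℤ.- q) i) , 𝔾-ext re-part (im-part b q)
  where
  open Data.Integer using (_+_; _-_) renaming (_*_ to _·_)
  t q : ℤ
  t = a + b
  q = t /ℕ 2
  s : ℕ
  s = t %ℕ 2
  isolate : ∀ a b → a ≡ (a + b) - b
  isolate = ℤSolver.solve-∀
  regroup : ∀ s q b → (s + q · + 2) - b ≡ s + (q · 1ℤ - (b - q) · 1ℤ)
  regroup = ℤSolver.solve-∀
  re-part : a ≡ + s + (q · 1ℤ - (b - q) · 1ℤ)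
  re-part = trans (isolate a b) (trans (cong (_- b) (a≡a%ℕn+[a/ℕn]*n t 2)) (regroup (+ s) q b))
  im-part : ∀ b q → b ≡ 0ℤ + (q · 1ℤ + (b - q) · 1ℤ)
  im-part = ℤSolver.solve-∀

even⊎≡1 : ∀ z → Even z ⊎ z ≡ᵍ 1ᵍ mod 1+i
even⊎≡1 z with residue-mod-1+i z
... | zero , _ , (w , z≡0+w[1+i]) = inj₁ (w , trans z≡0+w[1+i] (+ᵍ-identityˡ (w *ᵍ 1+i)))
... | suc zero , _ , z≡1 = inj₂ z≡1
... | suc (suc _) , ℕ.s≤s (ℕ.s≤s ()) , _

-- N (1 + i) = 2 while N 1 = 1 is odd.
¬even-1ᵍ : ¬ Even 1ᵍ
¬even-1ᵍ (c , 1≡c[1+i]) = ℕP.even≢odd (N c) 0 (sym (trans (cong N 1≡c[1+i]) (trans (N-* c 1+i) (ℕP.*-comm (N c) 2))))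

≡1⇒odd : ∀ {z} → z ≡ᵍ 1ᵍ mod 1+i → Odd z
≡1⇒odd (c , refl) (w , 1+c[1+i]≡w[1+i]) = ¬even-1ᵍ (w +ᵍ negᵍ c , (begin
  1ᵍ                                        ≡⟨ add-cancel c 1+i ⟩
  (1ᵍ +ᵍ c *ᵍ 1+i) +ᵍ negᵍ (c *ᵍ 1+i)       ≡⟨ cong (_+ᵍ negᵍ (c *ᵍ 1+i)) 1+c[1+i]≡w[1+i] ⟩
  w *ᵍ 1+i +ᵍ negᵍ (c *ᵍ 1+i)               ≡⟨ factor w c 1+i ⟩
  (w +ᵍ negᵍ c) *ᵍ 1+i                      ∎))
  where
  open ≡-Reasoning
  add-cancel : ∀ c k → 1ᵍ ≡ (1ᵍ +ᵍ c *ᵍ k) +ᵍ negᵍ (c *ᵍ k)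
  add-cancel = solve-∀ 𝔾-ring
  factor : ∀ w c k → w *ᵍ k +ᵍ negᵍ (c *ᵍ k) ≡ (w +ᵍ negᵍ c) *ᵍ k
  factor = solve-∀ 𝔾-ring

odd⇒≡1 : ∀ {z} → Odd z → z ≡ᵍ 1ᵍ mod 1+i
odd⇒≡1 {z} odd-z with even⊎≡1 z
... | inj₁ even-z = ⊥-elim (odd-z even-z)
... | inj₂ z≡1 = z≡1

-- For odd p, 1 + p ≡ 2 ≡ 0, so the parity of 1 + p + ⋯ + pᵏ alternates with k.
geomSum-+2 : ∀ {p} k → p ≡ᵍ 1ᵍ mod 1+i → geomSum p (suc (suc k)) ≡ᵍ geomSum p k mod 1+i
geomSum-+2 {p} k (c , refl) = p ^ᵍ suc k *ᵍ (conj 1+i +ᵍ c) , absorb (geomSum p k) (p ^ᵍ suc k) c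
  where
  absorb : ∀ g P c → (g +ᵍ P) +ᵍ (1ᵍ +ᵍ c *ᵍ 1+i) *ᵍ P ≡ g +ᵍ (P *ᵍ (conj 1+i +ᵍ c)) *ᵍ 1+i
  absorb = solve-∀ 𝔾-ring

geomSum-evenExp : ∀ {p} m → p ≡ᵍ 1ᵍ mod 1+i → geomSum p (2 * m) ≡ᵍ 1ᵍ mod 1+i
geomSum-evenExp zero _ = mod-refl 1ᵍ 1+i
geomSum-evenExp {p} (suc m) p≡1 = subst (λ k → geomSum p k ≡ᵍ 1ᵍ mod 1+i) (sym (ℕP.*-suc 2 m))
  (mod-trans (geomSum-+2 (2 * m) p≡1) (geomSum-evenExp m p≡1))

geomSum-oddExp : ∀ {p} m → p ≡ᵍ 1ᵍ mod 1+i → Even (geomSum p (suc (2 * m)))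
geomSum-oddExp zero (c , refl) = conj 1+i +ᵍ c , one-plus c
  where
  one-plus : ∀ c → 1ᵍ +ᵍ (1ᵍ +ᵍ c *ᵍ 1+i) *ᵍ 1ᵍ ≡ (conj 1+i +ᵍ c) *ᵍ 1+i
  one-plus = solve-∀ 𝔾-ring
geomSum-oddExp {p} (suc m) p≡1 = subst (λ k → Even (geomSum p (suc k))) (sym (ℕP.*-suc 2 m))
  (∣ᵍ-resp-mod (geomSum-+2 (suc (2 * m)) p≡1) (geomSum-oddExp m p≡1))

Odd-*⁻ˡ : ∀ {a} b → Odd (a *ᵍ b) → Odd a
Odd-*⁻ˡ b odd-ab even-a = odd-ab (∣ᵍ-*ʳ b even-a)

Odd-*⁻ʳ : ∀ a {b} → Odd (a *ᵍ b) → Odd b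
Odd-*⁻ʳ a odd-ab even-b = odd-ab (∣ᵍ-*ˡ a even-b)

Odd-^⁻ : ∀ {x} n → 1 ℕ.≤ n → Odd (x ^ᵍ n) → Odd x
Odd-^⁻ {x} (suc n) _ = Odd-*⁻ˡ (x ^ᵍ n)

^ᵍ-distribˡ-+-*ᵍ : ∀ x m n → x ^ᵍ (m ℕ.+ n) ≡ x ^ᵍ m *ᵍ x ^ᵍ n
^ᵍ-distribˡ-+-*ᵍ x zero n = sym (*ᵍ-identityˡ (x ^ᵍ n))
^ᵍ-distribˡ-+-*ᵍ x (suc m) n = trans (cong (x *ᵍ_) (^ᵍ-distribˡ-+-*ᵍ x m n)) (sym (*ᵍ-assoc x (x ^ᵍ m) (x ^ᵍ n)))

^ᵍ-double : ∀ x m → x ^ᵍ (2 * m) ≡ (x ^ᵍ m) ^ᵍ 2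
^ᵍ-double x m = trans (^ᵍ-distribˡ-+-*ᵍ x m (m ℕ.+ 0)) (cong (x ^ᵍ m *ᵍ_) (^ᵍ-distribˡ-+-*ᵍ x m 0))

^ᵍ-distribʳ-*ᵍ : ∀ x y n → (x *ᵍ y) ^ᵍ n ≡ x ^ᵍ n *ᵍ y ^ᵍ n
^ᵍ-distribʳ-*ᵍ x y zero = sym (*ᵍ-identityˡ 1ᵍ)
^ᵍ-distribʳ-*ᵍ x y (suc n) = trans (cong ((x *ᵍ y) *ᵍ_) (^ᵍ-distribʳ-*ᵍ x y n)) (interchange x y (x ^ᵍ n) (y ^ᵍ n))
  where
  interchange : ∀ x y a b → (x *ᵍ y) *ᵍ (a *ᵍ b) ≡ (x *ᵍ a) *ᵍ (y *ᵍ b)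
  interchange = solve-∀ 𝔾-ring

1ᵍ-^ᵍ : ∀ n → 1ᵍ ^ᵍ n ≡ 1ᵍ
1ᵍ-^ᵍ zero = refl
1ᵍ-^ᵍ (suc n) = trans (*ᵍ-identityˡ (1ᵍ ^ᵍ n)) (1ᵍ-^ᵍ n)

unit*oddPower≡ : ∀ ε ε' π γ m → 1ᵍ ≡ ε' *ᵍ ε →
  ε *ᵍ (π ^ᵍ suc (2 * m) *ᵍ γ ^ᵍ 2) ≡ (ε *ᵍ π) ^ᵍ suc (2 * m) *ᵍ (ε' ^ᵍ m *ᵍ γ) ^ᵍ 2
unit*oddPower≡ ε ε' π γ m 1≡ε'ε = sym (begin
  (ε *ᵍ π) ^ᵍ k *ᵍ (ε' ^ᵍ m *ᵍ γ) ^ᵍ 2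
    ≡⟨ cong₂ _*ᵍ_ (^ᵍ-distribʳ-*ᵍ ε π k) (^ᵍ-distribʳ-*ᵍ (ε' ^ᵍ m) γ 2) ⟩
  (ε *ᵍ ε ^ᵍ (2 * m)) *ᵍ π ^ᵍ k *ᵍ ((ε' ^ᵍ m) ^ᵍ 2 *ᵍ γ ^ᵍ 2)
    ≡⟨ cong (λ z → (ε *ᵍ z) *ᵍ π ^ᵍ k *ᵍ ((ε' ^ᵍ m) ^ᵍ 2 *ᵍ γ ^ᵍ 2)) (^ᵍ-double ε m) ⟩
  (ε *ᵍ (ε ^ᵍ m) ^ᵍ 2) *ᵍ π ^ᵍ k *ᵍ ((ε' ^ᵍ m) ^ᵍ 2 *ᵍ γ ^ᵍ 2)
    ≡⟨ regroup ε (ε ^ᵍ m) (ε' ^ᵍ m) (π ^ᵍ k) γ ⟩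
  ε *ᵍ (π ^ᵍ k *ᵍ γ ^ᵍ 2) *ᵍ (ε' ^ᵍ m *ᵍ ε ^ᵍ m) ^ᵍ 2
    ≡⟨ cong (λ z → ε *ᵍ (π ^ᵍ k *ᵍ γ ^ᵍ 2) *ᵍ z ^ᵍ 2) ε'ᵐεᵐ≡1 ⟩
  ε *ᵍ (π ^ᵍ k *ᵍ γ ^ᵍ 2) *ᵍ 1ᵍ ^ᵍ 2
    ≡⟨ *ᵍ-identityʳ (ε *ᵍ (π ^ᵍ k *ᵍ γ ^ᵍ 2)) ⟩
  ε *ᵍ (π ^ᵍ k *ᵍ γ ^ᵍ 2) ∎)
  where
  open ≡-Reasoning
  k : ℕ
  k = suc (2 * m)
  -- The solver does not know _^ᵍ_: squares are written out as x ^ᵍ 2 unfolds.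
  regroup : ∀ ε E F P γ →
    (ε *ᵍ (E *ᵍ (E *ᵍ 1ᵍ))) *ᵍ P *ᵍ ((F *ᵍ (F *ᵍ 1ᵍ)) *ᵍ (γ *ᵍ (γ *ᵍ 1ᵍ))) ≡
    ε *ᵍ (P *ᵍ (γ *ᵍ (γ *ᵍ 1ᵍ))) *ᵍ ((F *ᵍ E) *ᵍ ((F *ᵍ E) *ᵍ 1ᵍ))
  regroup = solve-∀ 𝔾-ring
  ε'ᵐεᵐ≡1 : ε' ^ᵍ m *ᵍ ε ^ᵍ m ≡ 1ᵍ
  ε'ᵐεᵐ≡1 = trans (sym (^ᵍ-distribʳ-*ᵍ ε' ε m)) (trans (cong (_^ᵍ m) (sym 1≡ε'ε)) (1ᵍ-^ᵍ m))

absorbUnit : ∀ {α ε π γ} k → (∃ λ m → k ≡ suc (2 * m)) → IsUnit ε → GaussianPrime π → ¬ π ∣ᵍ γ →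
  α ≡ ε *ᵍ (π ^ᵍ k *ᵍ γ ^ᵍ 2) →
  ∃ λ (π' : 𝔾) → ∃ λ (γ' : 𝔾) → ∃ λ (k' : ℕ) →
    GaussianPrime π' × CoprimeG π' γ' × (∃ λ m → k' ≡ suc (2 * m)) × α ≡ (π' ^ᵍ k') *ᵍ (γ' ^ᵍ 2)
absorbUnit {ε = ε} {π} {γ} k (m , refl) ε-unit@(ε' , 1≡ε'ε) π-prime π∤γ α≡ =
  ε *ᵍ π , ε' ^ᵍ m *ᵍ γ , k , επ-prime , prime∤⇒coprime επ-prime επ∤ε'ᵐγ , (m , refl) ,
  trans α≡ (unit*oddPower≡ ε ε' π γ m 1≡ε'ε)
  where
  επ-prime : GaussianPrime (ε *ᵍ π)
  επ-prime = unit*prime ε-unit π-prime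
  επ∤ε'ᵐγ : ¬ (ε *ᵍ π) ∣ᵍ (ε' ^ᵍ m *ᵍ γ)
  επ∤ε'ᵐγ επ∣ε'ᵐγ = π∤γ (∣ᵍ-unit-*⁻ (IsUnit-^ m (ε , trans 1≡ε'ε (*ᵍ-comm ε' ε))) (∣ᵍ-trans (ε , refl) επ∣ε'ᵐγ))

-- Factorisations into prime powers

EvenExp OddExp : PrimePower → Set
EvenExp f = ∃ λ m → exp f ≡ 2 * m
OddExp f = ∃ λ m → exp f ≡ suc (2 * m)

even⊎odd : ∀ n → (∃ λ m → n ≡ 2 * m) ⊎ (∃ λ m → n ≡ suc (2 * m))
even⊎odd zero = inj₁ (0 , refl)
even⊎odd (suc n) with even⊎odd n
... | inj₁ (m , refl) = inj₂ (m , refl)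
... | inj₂ (m , refl) = inj₁ (suc m , sym (cong suc (ℕP.+-suc m (m ℕ.+ 0))))

firstOddExp : ∀ fs → All EvenExp fs ⊎ ∃₂ λ pre f → ∃ λ post → fs ≡ pre ++ f ∷ post × All EvenExp pre × OddExp f
firstOddExp [] = inj₁ []
firstOddExp (f ∷ fs) with even⊎odd (exp f) | firstOddExp fs
... | inj₂ odd-f | _ = inj₂ ([] , f , fs , refl , [] , odd-f)
... | inj₁ even-f | inj₁ even-fs = inj₁ (even-f ∷ even-fs)
... | inj₁ even-f | inj₂ (pre , g , post , refl , even-pre , odd-g) = inj₂ (f ∷ pre , g , post , refl , even-f ∷ even-pre , odd-g)

AllPairs-middle : ∀ {R : PrimePower → PrimePower → Set} xs y zs →
  AllPairs R (xs ++ y ∷ zs) → All (λ x → R x y) xs × All (R y) zs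
AllPairs-middle [] y zs (Ryzs ∷ _) = [] , Ryzs
AllPairs-middle (x ∷ xs) y zs (Rx[xs++y∷zs] ∷ pairs) with All.++⁻ʳ xs Rx[xs++y∷zs] | AllPairs-middle xs y zs pairs
... | Rxy ∷ _ | Rxsy , Ryzs = Rxy ∷ Rxsy , Ryzs

prodG-++ : ∀ xs ys → prodG (xs ++ ys) ≡ prodG xs *ᵍ prodG ys
prodG-++ [] ys = sym (*ᵍ-identityˡ (prodG ys))
prodG-++ (x ∷ xs) ys = trans (cong (x *ᵍ_) (prodG-++ xs ys)) (sym (*ᵍ-assoc x (prodG xs) (prodG ys)))

prodG-map-middle : ∀ (h : PrimePower → 𝔾) xs y zs →
  prodG (map h (xs ++ y ∷ zs)) ≡ prodG (map h xs) *ᵍ (h y *ᵍ prodG (map h zs))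
prodG-map-middle h xs y zs = trans (cong prodG (map-++ h xs (y ∷ zs))) (prodG-++ (map h xs) (map h (y ∷ zs)))

powers : List PrimePower → 𝔾
powers fs = prodG (map (λ f → base f ^ᵍ exp f) fs)

halfPowers : (fs : List PrimePower) → All EvenExp fs → 𝔾
halfPowers [] [] = 1ᵍ
halfPowers (f ∷ fs) ((m , _) ∷ even-fs) = base f ^ᵍ m *ᵍ halfPowers fs even-fs

powers≡halfPowers² : ∀ fs (even-fs : All EvenExp fs) → powers fs ≡ halfPowers fs even-fs ^ᵍ 2
powers≡halfPowers² [] [] = refl
powers≡halfPowers² (f ∷ fs) ((m , em) ∷ even-fs) = begin
  base f ^ᵍ exp f *ᵍ powers fs                         ≡⟨ cong₂ _*ᵍ_ (trans (cong (base f ^ᵍ_) em) (^ᵍ-double (base f) m)) (powers≡halfPowers² fs even-fs) ⟩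
  (base f ^ᵍ m) ^ᵍ 2 *ᵍ halfPowers fs even-fs ^ᵍ 2     ≡⟨ ^ᵍ-distribʳ-*ᵍ (base f ^ᵍ m) (halfPowers fs even-fs) 2 ⟨
  (base f ^ᵍ m *ᵍ halfPowers fs even-fs) ^ᵍ 2         ∎
  where open ≡-Reasoning

oddBases : ∀ fs → All ValidPP fs → Odd (powers fs) → All (λ f → Odd (base f)) fs
oddBases [] [] _ = []
oddBases (f ∷ fs) ((_ , _ , 1≤k) ∷ valid) odd =
  Odd-^⁻ (exp f) 1≤k (Odd-*⁻ˡ (powers fs) odd) ∷ oddBases fs valid (Odd-*⁻ʳ (base f ^ᵍ exp f) odd)

prime∤halfPowers : ∀ {π} fs (even-fs : All EvenExp fs) → GaussianPrime π →
  All (λ f → GaussianPrime (base f) × ¬ Associated π (base f)) fs → ¬ π ∣ᵍ halfPowers fs even-fs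
prime∤halfPowers [] [] π-prime [] = prime∤1 π-prime
prime∤halfPowers (f ∷ fs) ((m , _) ∷ even-fs) π-prime ((f-prime , π≁f) ∷ rest) π∣
  with euclidsLemma _ (base f ^ᵍ m) (halfPowers fs even-fs) π-prime π∣
... | inj₁ π∣fᵐ = π≁f (prime∣prime⇒associated π-prime f-prime (prime∣^⇒prime∣ (base f) m π-prime π∣fᵐ))
... | inj₂ π∣rest = prime∤halfPowers fs even-fs π-prime rest π∣rest

σ-of-allEvenExp : ∀ fs → All (λ f → Odd (base f)) fs → All EvenExp fs → σ-of fs ≡ᵍ 1ᵍ mod 1+i
σ-of-allEvenExp [] [] [] = mod-refl 1ᵍ 1+i
σ-of-allEvenExp (f ∷ fs) (odd-f ∷ odd-fs) ((m , em) ∷ even-fs) = mod-*-cong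
  (subst (λ k → geomSum (base f) k ≡ᵍ 1ᵍ mod 1+i) (sym em) (geomSum-evenExp m (odd⇒≡1 odd-f)))
  (σ-of-allEvenExp fs odd-fs even-fs)

even-geomSum-oddExp : ∀ f → Odd (base f) → OddExp f → Even (geomSum (base f) (exp f))
even-geomSum-oddExp f odd-f (m , em) = subst (λ k → Even (geomSum (base f) k)) (sym em) (geomSum-oddExp m (odd⇒≡1 odd-f))

-- No odd exponent would make σ odd; two would make (1 + i)² divide σ = (1 + i) α, hence 1 + i divide α.
uniqueOddExp : ∀ {α} fs → Odd α → All (λ f → Odd (base f)) fs → σ-of fs ≡ 1+i *ᵍ α →
  ∃₂ λ pre f → ∃ λ post → fs ≡ pre ++ f ∷ post × All EvenExp pre × OddExp f × All EvenExp post
uniqueOddExp {α} fs odd-α odd-bases σ≡ with firstOddExp fs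
... | inj₁ even-fs = ⊥-elim (≡1⇒odd (σ-of-allEvenExp fs odd-bases even-fs) (subst Even (sym σ≡) (α , *ᵍ-comm 1+i α)))
... | inj₂ (pre , f , post , refl , even-pre , odd-f) with firstOddExp post
...   | inj₁ even-post = pre , f , post , refl , even-pre , odd-f , even-post
...   | inj₂ (pre' , g , post' , refl , _ , odd-g) = ⊥-elim (odd-α (∣ᵍ-cancelˡ 1+i (λ ()) [1+i]²∣[1+i]α))
  where
  gs : PrimePower → 𝔾
  gs h = geomSum (base h) (exp h)
  odd-f∷post : All (λ h → Odd (base h)) (f ∷ pre' ++ g ∷ post')
  odd-f∷post = All.++⁻ʳ pre odd-bases
  odd-g∷post' : All (λ h → Odd (base h)) (g ∷ post')
  odd-g∷post' = All.++⁻ʳ pre' (tail odd-f∷post)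
  even-σ-post : Even (σ-of post)
  even-σ-post = subst (1+i ∣ᵍ_) (sym (prodG-map-middle gs pre' g post'))
    (∣ᵍ-*ˡ (σ-of pre') (∣ᵍ-*ʳ (σ-of post') (even-geomSum-oddExp g (head odd-g∷post') odd-g)))
  [1+i]²∣[1+i]α : (1+i *ᵍ 1+i) ∣ᵍ (1+i *ᵍ α)
  [1+i]²∣[1+i]α = subst ((1+i *ᵍ 1+i) ∣ᵍ_) (trans (sym (prodG-map-middle gs pre f post)) σ≡)
    (∣ᵍ-*ˡ (σ-of pre) (*ᵍ-∣ᵍ-* (even-geomSum-oddExp f (head odd-f∷post) odd-f) even-σ-post))

powers-around : ∀ pre f post (even-pre : All EvenExp pre) (even-post : All EvenExp post) →
  powers (pre ++ f ∷ post) ≡ base f ^ᵍ exp f *ᵍ (halfPowers pre even-pre *ᵍ halfPowers post even-post) ^ᵍ 2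
powers-around pre f post even-pre even-post = begin
  powers (pre ++ f ∷ post)                       ≡⟨ prodG-map-middle (λ g → base g ^ᵍ exp g) pre f post ⟩
  powers pre *ᵍ (πᵏ *ᵍ powers post)              ≡⟨ cong₂ (λ A B → A *ᵍ (πᵏ *ᵍ B)) (powers≡halfPowers² pre even-pre) (powers≡halfPowers² post even-post) ⟩
  Hpre ^ᵍ 2 *ᵍ (πᵏ *ᵍ Hpost ^ᵍ 2)                ≡⟨ regroup Hpre πᵏ Hpost ⟩
  πᵏ *ᵍ (Hpre *ᵍ Hpost) ^ᵍ 2                      ∎
  where
  open ≡-Reasoning
  πᵏ Hpre Hpost : 𝔾
  πᵏ = base f ^ᵍ exp f
  Hpre = halfPowers pre even-pre
  Hpost = halfPowers post even-post
  regroup : ∀ A P B → (A *ᵍ (A *ᵍ 1ᵍ)) *ᵍ (P *ᵍ (B *ᵍ (B *ᵍ 1ᵍ))) ≡ P *ᵍ ((A *ᵍ B) *ᵍ ((A *ᵍ B) *ᵍ 1ᵍ))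
  regroup = solve-∀ 𝔾-ring

base∤halfPowers-around : ∀ pre f post → All ValidPP (pre ++ f ∷ post) →
  AllPairs (λ f g → ¬ Associated (base f) (base g)) (pre ++ f ∷ post) →
  (even-pre : All EvenExp pre) (even-post : All EvenExp post) →
  ¬ base f ∣ᵍ (halfPowers pre even-pre *ᵍ halfPowers post even-post)
base∤halfPowers-around pre f post valid distinct even-pre even-post π∣γ =
  [ prime∤halfPowers pre even-pre π-prime (zipWith (λ (v , f≁π) → proj₁ v , λ π≈f → f≁π (associated-sym π≈f)) (valid-pre , f≁pre))
  , prime∤halfPowers post even-post π-prime (zipWith (λ (v , π≁f) → proj₁ v , π≁f) (valid-post , π≁post))
  ]′ (euclidsLemma (base f) (halfPowers pre even-pre) (halfPowers post even-post) π-prime π∣γ)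
  where
  valid-pre : All ValidPP pre
  valid-pre = All.++⁻ˡ pre valid
  valid-post : All ValidPP post
  valid-post = tail (All.++⁻ʳ pre valid)
  π-prime : GaussianPrime (base f)
  π-prime = proj₁ (head (All.++⁻ʳ pre valid))
  f≁pre : All (λ g → ¬ Associated (base g) (base f)) pre
  f≁pre = proj₁ (AllPairs-middle pre f post distinct)
  π≁post : All (λ g → ¬ Associated (base f) (base g)) post
  π≁post = proj₂ (AllPairs-middle pre f post distinct)

mainTheorem3 : (α : 𝔾) → Odd α → Perfect α →
    ∃ λ (π : 𝔾) → ∃ λ (γ : 𝔾) → ∃ λ (k : ℕ) →
      GaussianPrime π × CoprimeG π γ × (∃ λ m → k ≡ suc (2 * m)) ×
      α ≡ (π ^ᵍ k) *ᵍ (γ ^ᵍ 2)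
mainTheorem3 α odd-α (ε , fs , (ε-unit , valid , distinct , α≡εP) , σ≡[1+i]α)
  with uniqueOddExp fs odd-α (oddBases fs valid (Odd-*⁻ʳ ε (subst Odd α≡εP odd-α))) σ≡[1+i]α
... | pre , f , post , refl , even-pre , odd-f , even-post =
  absorbUnit (exp f) odd-f ε-unit (proj₁ (head (All.++⁻ʳ pre valid)))
    (base∤halfPowers-around pre f post valid distinct even-pre even-post)
    (trans α≡εP (cong (ε *ᵍ_) (powers-around pre f post even-pre even-post)))
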